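{- Let $(E,f,S)$ be a (possibly incoherent) partial Dowling geometry of rank $r$. Let $s^{(1)},\ldots,s^{(n)}\in S$ (not necessarily distinct) and for each $1\le t\le n$ let $1\le i_{t},j_{t}\le r$ be distinct indices, such that $\{i_{t},j_{t}\}\neq\{i_{u},j_{u}\}$ whenever $t\neq u$. Let $A=\{s^{(t)}_{i_{t},j_{t}}\}_{1\le t\le n}$ and assume $s^{(t)}_{i_{t},j_{t}}\in E$ for all $t$. If the subgraph $G$ of the complete graph $K_{r}$ with edge set $\{\{i_{t},j_{t}\}\mid 1\le t\le n\}$ and vertex set $\bigcup_{t}\{i_{t},j_{t}\}$ contains no cycle, then $f(A)=n$.
   Context: A polymatroid is $(E,f)$ with $f:\mathcal{P}(E)\to\mathbb{R}$, $f(\emptyset)=0$, monotone, submodular (and of finite type, $f(S)=\sup_{F\subseteq S\text{ finite}}f(F)$, if $E$ is infinite); $f(a_1,\dots,a_k):=f(\{a_1,\dots,a_k\})$ and $\mathrm{cl}(A)=\{x\in E\mid f(A\cup\{x\})=f(A)\}$. A partial Dowling geometry (PDG) of rank $r$ is a triple $(E,f,S)$ where $(E,f)$ is a polymatroid and: (1) $S$ is a set with an involution $s\mapsto s^{ -1}$ and a distinguished element $e$ with $e^{ -1}=e$; (2) $E$ contains $B=\{b_1,\ldots,b_r\}$ with $f(A)=|A|$ for all $A\subseteq B$; (3) for each $1\le i<j\le r$, $E$ contains a copy $\{s_{i,j}\mid s\in S\}$ of $S$, these copies pairwise disjoint and disjoint from $B$, and $E=B\sqcup\bigsqcup_{i<j}\{s_{i,j}\mid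 s\in S\}$; one sets $s_{i,j}^{ -1}:=(s^{ -1})_{i,j}$, and for $i<j$, $s_{j,i}:=s_{i,j}^{ -1}$ and $s_{j,i}^{ -1}:=s_{i,j}$; (4) $s_{i,j}\in\mathrm{cl}(b_i,b_j)$ for all distinct $i,j$; (5) $f(s_{i,j})=1$ and $f(b_i,s_{i,j})=2$ for all $s\in S$ and distinct $i,j$; (6) $f(s_{i,j},s^{ -1}_{j,k},e_{k,i})=2$ for all $s\in S$ and distinct $i,j,k$. An incoherent PDG is a triple satisfying all these except (3) and (6); instead of (3) one only requires $B\subseteq E\subseteq B\sqcup\bigsqcup_{i<j}\{s_{i,j}\mid s\in S\}$, with (4),(5) required only for those $s_{i,j}$ lying in $E$ (and still $s_{j,i}^{ -1}=s_{i,j}$). "Possibly incoherent PDG" means a PDG or an incoherent PDG. -}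

module Defs where

open import Level using (0ℓ) renaming (suc to lsuc)
open import Data.Nat using (ℕ; zero; suc)
open import Data.Fin using (Fin; zero; suc; _<_; inject₁; fromℕ)
open import Data.Fin.Properties using (<-cmp)
open import Data.Fin.Subset using (Subset; _∈_; ∣_∣)
open import Data.List using (List; []; _∷_)
import Data.List.Membership.Propositional as LM
open import Data.Product using (Σ; ∃; _×_; _,_)
open import Data.Sum using (_⊎_)
open import Relation.Nullary using (¬_)
open import Relation.Binary using (Rel; IsTotalOrder; tri<; tri≈; tri>)
open import Relation.Binary.PropositionalEquality using (_≡_; _≢_)
open import Relation.Unary using (Pred; _⊆_; _∪_; _∩_; ∅)
open import Algebra.Bundles using (CommutativeRing)
open import Function.Definitions using (Injective)

-- Abstract model of the real numbers: a Dedekind-complete ordered field.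
-- (Every such structure is isomorphic to ℝ.)

record RealField : Set₁ where
  field
    cring : CommutativeRing 0ℓ 0ℓ
  open CommutativeRing cring public
  field
    _≤_          : Rel Carrier 0ℓ
    isTotalOrder : IsTotalOrder _≈_ _≤_
    +-mono-≤     : ∀ {x y} z → x ≤ y → (x + z) ≤ (y + z)
    *-nonneg     : ∀ {x y} → 0# ≤ x → 0# ≤ y → 0# ≤ (x * y)
    0≉1          : ¬ (0# ≈ 1#)
    inverse      : ∀ x → ¬ (x ≈ 0#) → Σ Carrier (λ y → (x * y) ≈ 1#)
    complete     : (P : Pred Carrier 0ℓ) → ∃ P → ∃ (λ u → ∀ x → P x → x ≤ u) →
                   ∃ (λ s → (∀ x → P x → x ≤ s) ×
                            (∀ u → (∀ x → P x → x ≤ u) → s ≤ u))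

  fromℕ' : ℕ → Carrier
  fromℕ' zero    = 0#
  fromℕ' (suc n) = 1# + fromℕ' n

-- Subsets are predicates; f is given on all subsets of G, but the axioms
-- are only imposed on subsets of E (values elsewhere are irrelevant).

⟦_⟧ : {G : Set} → List G → Pred G 0ℓ
⟦ xs ⟧ = λ g → g LM.∈ xs

record IsPolymatroid (R : RealField) {G : Set} (E : Pred G 0ℓ)
                     (f : Pred G 0ℓ → RealField.Carrier R) : Set₁ where
  open RealField R
  field
    f-∅        : f ∅ ≈ 0#
    monotone   : ∀ {X Y} → Y ⊆ E → X ⊆ Y → f X ≤ f Y
    submodular : ∀ {X Y} → X ⊆ E → Y ⊆ E → (f (X ∪ Y) + f (X ∩ Y)) ≤ (f X + f Y)
    -- finite type: f(X) = sup { f(F) | F ⊆ X finite }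
    finiteType : ∀ {X} → X ⊆ E → ∀ u →
                 (∀ (xs : List G) → ⟦ xs ⟧ ⊆ X → f ⟦ xs ⟧ ≤ u) → f X ≤ u

-- Ground set of a (partial) Dowling geometry of rank r over S:
-- B = {b_1..b_r} disjoint union the copies {s_{i,j} | s ∈ S}, i < j.

data Ground (r : ℕ) (S : Set) : Set where
  b  : Fin r → Ground r S
  el : (i j : Fin r) → i < j → S → Ground r S

-- s_{i,j} for arbitrary i,j, with the convention s_{j,i} := (s⁻¹)_{i,j}
-- for i < j (the value for i = j is junk, never used).
module _ {r : ℕ} {S : Set} (inv : S → S) where
  sub : Fin r → Fin r → S → Ground r S
  sub i j s with <-cmp i j
  ... | tri< i<j _ _ = el i j i<j s
  ... | tri≈ _ _ _   = b i
  ... | tri> _ _ j<i = el j i j<i (inv s)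

record IncoherentPDG (R : RealField) (r : ℕ) (S : Set) (inv : S → S) (e : S)
                     (E : Pred (Ground r S) 0ℓ)
                     (f : Pred (Ground r S) 0ℓ → RealField.Carrier R) : Set₁ where
  open RealField R
  field
    inv-invol : ∀ s → inv (inv s) ≡ s
    inv-e     : inv e ≡ e
    polymatroid : IsPolymatroid R E f
    B⊆E  : ∀ i → E (b i)
    indepB : ∀ (P : Subset r) → f (λ g → ∃ λ i → g ≡ b i × i ∈ P) ≈ fromℕ' ∣ P ∣
    inCl : ∀ (i j : Fin r) (s : S) → i ≢ j → E (sub inv i j s) →
           f ⟦ b i ∷ b j ∷ sub inv i j s ∷ [] ⟧ ≈ f ⟦ b i ∷ b j ∷ [] ⟧
    rank1  : ∀ (i j : Fin r) (s : S) → i ≢ j → E (sub inv i j s) →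
             f ⟦ sub inv i j s ∷ [] ⟧ ≈ 1#
    rankbi : ∀ (i j : Fin r) (s : S) → i ≢ j → E (sub inv i j s) →
             f ⟦ b i ∷ sub inv i j s ∷ [] ⟧ ≈ (1# + 1#)

record PDG (R : RealField) (r : ℕ) (S : Set) (inv : S → S) (e : S)
           (E : Pred (Ground r S) 0ℓ)
           (f : Pred (Ground r S) 0ℓ → RealField.Carrier R) : Set₁ where
  open RealField R
  field
    base : IncoherentPDG R r S inv e E f
    E-all : ∀ g → E g
    triangle : ∀ (i j k : Fin r) (s : S) → i ≢ j → j ≢ k → i ≢ k →
               f ⟦ sub inv i j s ∷ sub inv j k (inv s) ∷ sub inv k i e ∷ [] ⟧ ≈ (1# + 1#)

PossiblyIncoherentPDG : (R : RealField) (r : ℕ) (S : Set) (inv : S → S) (e : S)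
  (E : Pred (Ground r S) 0ℓ) (f : Pred (Ground r S) 0ℓ → RealField.Carrier R) → Set₁
PossiblyIncoherentPDG R r S inv e E f = PDG R r S inv e E f ⊎ IncoherentPDG R r S inv e E f

Adj : {n r : ℕ} → (Fin n → Fin r) → (Fin n → Fin r) → Fin r → Fin r → Set
Adj {n} i j x y = ∃ λ (t : Fin n) → (i t ≡ x × j t ≡ y) ⊎ (i t ≡ y × j t ≡ x)

HasCycle : {n r : ℕ} → (Fin n → Fin r) → (Fin n → Fin r) → Set
HasCycle {n} {r} i j =
  ∃ λ (k : ℕ) → ∃ λ (v : Fin (suc (suc (suc k))) → Fin r) →
    Injective _≡_ _≡_ v ×
    (∀ (m : Fin (suc (suc k))) → Adj i j (v (inject₁ m)) (v (suc m))) ×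
    Adj i j (v (fromℕ (suc (suc k)))) (v zero)

{-# OPTIONS --safe #-}
module Submission where

open import Defs
open import Level using (0ℓ)
open import Data.Nat using (ℕ)
open import Data.Fin using (Fin)
open import Data.Product using (∃; _×_)
open import Data.Sum using (_⊎_)
open import Relation.Nullary using (¬_)
open import Relation.Binary.PropositionalEquality using (_≡_; _≢_)
open import Relation.Unary using (Pred)

open import Data.Nat as ℕ using (zero; suc; s≤s; s<s⁻¹)
import Data.Nat.Properties as ℕ
open import Data.Fin as Fin using (zero; suc; toℕ; inject₁; punchIn; punchOut)
import Data.Fin.Properties as Fin
open import Data.Fin.Subset using (Subset; _∈_; ∣_∣; ⁅_⁆; ∁; ⊤)
open import Data.Fin.Subset.Properties
  using (∣⊤∣≡n; ∣∁p∣≡n∸∣p∣; ∣⁅x⁆∣≡1; x∈⁅x⁆; x∈⁅y⁆⇒x≡y; x≢y⇒x∉⁅y⁆; x∉p⇒x∈∁p)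
open import Data.List using ([]; _∷_; _++_)
open import Data.List.Relation.Unary.Any using (here; there)
open import Data.List.Relation.Unary.All using (All; []; _∷_; lookup)
open import Data.List.Membership.Propositional.Properties using (∈-++⁺ˡ; ∈-++⁺ʳ; ∈-++⁻)
open import Data.List.Relation.Binary.Permutation.Propositional using (_↭_; ↭-sym; prep; swap; refl)
open import Data.List.Relation.Binary.Permutation.Propositional.Properties using (∈-resp-↭)
open import Data.Product using (_,_; proj₁; proj₂)
open import Data.Sum using (inj₁; inj₂; [_,_]′)
open import Data.Empty using (⊥; ⊥-elim)
open import Function using (_∘_; id)
open import Function.Definitions using (Injective)
open import Relation.Nullary using (Dec; yes; no; ¬?)
open import Relation.Nullary.Decidable using (_×-dec_; _⊎-dec_)
open import Relation.Binary using (Poset; IsTotalOrder; tri<; tri≈; tri>)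
open import Relation.Binary.PropositionalEquality using (refl; sym; cong; cong₂; subst; ≢-sym)
import Relation.Binary.Reasoning.PartialOrder as PosetReasoning
import Relation.Binary.Reasoning.Setoid as SetoidReasoning
open import Relation.Unary using (_⊆_; _∪_; _∩_; ∅; _≐_)
import Algebra.Properties.Group as GroupProperties

-- A forest with an edge has an edge t one of whose endpoints,
-- v, meets no other edge; let w be the other endpoint, a the element of A on
-- the line through b_w and b_v, and A' = A ∖ {a}.  Then f(A) ≤ f(A') + f(a) =
-- f(A') + 1.  Conversely put X = A' ∪ {b_x | x ≠ v}.  Every element of A' lies
-- in the closure of two of these b_x, so f(X) = r − 1; and b_v lies in the
-- closure of {b_w, a}, since f(b_w, b_v, a) = f(b_w, b_v) = 2 = f(b_w, a), so
-- A ∪ X spans all of B and f(A ∪ X) = r.  Submodularity applied to A and X,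
-- with A' ⊆ A ∩ X, gives r + f(A') ≤ f(A) + (r − 1).

module OrderedFieldProperties (R : RealField) where
  open RealField R hiding (+-mono-≤)

  ≤-poset : Poset 0ℓ 0ℓ 0ℓ
  ≤-poset = record { isPartialOrder = IsTotalOrder.isPartialOrder isTotalOrder }

  open Poset ≤-poset public using (antisym) renaming (reflexive to ≤-reflexive; trans to ≤-trans)

  module ≤-Reasoning = PosetReasoning ≤-poset
  module ≈-Reasoning = SetoidReasoning setoid

  open ≤-Reasoning
  open GroupProperties +-group using (//-rightDividesʳ)

  +-monoˡ-≤ : ∀ z {x y} → x ≤ y → (x + z) ≤ (y + z)
  +-monoˡ-≤ z = RealField.+-mono-≤ R z

  +-monoʳ-≤ : ∀ z {x y} → x ≤ y → (z + x) ≤ (z + y)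
  +-monoʳ-≤ z {x} {y} x≤y = begin
    z + x  ≈⟨ +-comm z x ⟩
    x + z  ≤⟨ +-monoˡ-≤ z x≤y ⟩
    y + z  ≈⟨ +-comm y z ⟩
    z + y  ∎

  +-mono-≤ : ∀ {x y u v} → x ≤ y → u ≤ v → (x + u) ≤ (y + v)
  +-mono-≤ {y = y} {u} x≤y u≤v = ≤-trans (+-monoˡ-≤ u x≤y) (+-monoʳ-≤ y u≤v)

  +-cancelʳ-≤ : ∀ z {x y} → (x + z) ≤ (y + z) → x ≤ y
  +-cancelʳ-≤ z {x} {y} x+z≤y+z = begin
    x            ≈⟨ //-rightDividesʳ z x ⟨
    x + z + - z  ≤⟨ +-monoˡ-≤ (- z) x+z≤y+z ⟩
    y + z + - z  ≈⟨ //-rightDividesʳ z y ⟩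
    y            ∎

  x≤x+y : ∀ {x y} → 0# ≤ y → x ≤ (x + y)
  x≤x+y {x} {y} 0≤y = begin
    x       ≈⟨ +-identityʳ x ⟨
    x + 0#  ≤⟨ +-monoʳ-≤ x 0≤y ⟩
    x + y   ∎

Range : {G : Set} {n : ℕ} → (Fin n → G) → Pred G 0ℓ
Range g y = ∃ λ t → y ≡ g t

module _ {G : Set} {n : ℕ} {g : Fin n → G} where

  Range-⊆ : {E : Pred G 0ℓ} → (∀ t → E (g t)) → Range g ⊆ E
  Range-⊆ Eg (t , refl) = Eg t

  Range-∘-⊆ : ∀ {m} (h : Fin m → Fin n) → Range (g ∘ h) ⊆ Range g
  Range-∘-⊆ h (t , y≡) = h t , y≡

Range-⊆-punchIn : ∀ {G : Set} {n} (g : Fin (suc n) → G) t →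
                  Range g ⊆ Range (g ∘ punchIn t) ∪ ⟦ g t ∷ [] ⟧
Range-⊆-punchIn g t (u , refl) with u Fin.≟ t
... | yes refl = inj₂ (here refl)
... | no u≢t   = inj₁ (punchOut (≢-sym u≢t) , cong g (sym (Fin.punchIn-punchOut (≢-sym u≢t))))

module PolymatroidProperties (R : RealField) {G : Set} {E : Pred G 0ℓ}
  {f : Pred G 0ℓ → RealField.Carrier R} (P : IsPolymatroid R E f) where
  open RealField R using (_≈_; _≤_; _+_; 0#)
  open OrderedFieldProperties R
  open IsPolymatroid P

  _⊆cl_ : Pred G 0ℓ → Pred G 0ℓ → Set
  X ⊆cl Y = f (Y ∪ X) ≤ f Y

  ∪-⊆ : ∀ {X Y : Pred G 0ℓ} → X ⊆ E → Y ⊆ E → X ∪ Y ⊆ E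
  ∪-⊆ X⊆E Y⊆E = [ X⊆E , Y⊆E ]′

  ⟦x⟧⊆E : ∀ {x} → E x → ⟦ x ∷ [] ⟧ ⊆ E
  ⟦x⟧⊆E Ex (here refl) = Ex

  f-resp-≐ : ∀ {X Y : Pred G 0ℓ} → X ⊆ E → X ≐ Y → f X ≈ f Y
  f-resp-≐ X⊆E (X⊆Y , Y⊆X) = antisym (monotone (X⊆E ∘ Y⊆X) X⊆Y) (monotone X⊆E Y⊆X)

  f-nonneg : ∀ {X : Pred G 0ℓ} → X ⊆ E → 0# ≤ f X
  f-nonneg {X} X⊆E = begin
    0#   ≈⟨ f-∅ ⟨
    f ∅  ≤⟨ monotone X⊆E (λ ()) ⟩
    f X  ∎
    where open ≤-Reasoning

  f-Range-Fin0 : (g : Fin 0 → G) → f (Range g) ≈ 0#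
  f-Range-Fin0 g = begin
    f (Range g)  ≈⟨ f-resp-≐ (λ { (() , _) }) ((λ { (() , _) }) , λ ()) ⟩
    f ∅          ≈⟨ f-∅ ⟩
    0#           ∎
    where open ≈-Reasoning

  f-subadditive : ∀ {X Y : Pred G 0ℓ} → X ⊆ E → Y ⊆ E → f (X ∪ Y) ≤ (f X + f Y)
  f-subadditive X⊆E Y⊆E = ≤-trans (x≤x+y (f-nonneg (X⊆E ∘ proj₁))) (submodular X⊆E Y⊆E)

  f-++ : ∀ xs ys → All E (xs ++ ys) → f ⟦ xs ++ ys ⟧ ≈ f (⟦ xs ⟧ ∪ ⟦ ys ⟧)
  f-++ xs ys xs++ys∈E = f-resp-≐ (lookup xs++ys∈E) (∈-++⁻ xs , [ ∈-++⁺ˡ , ∈-++⁺ʳ xs ]′)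

  f-resp-↭ : ∀ {xs ys} → All E xs → xs ↭ ys → f ⟦ xs ⟧ ≈ f ⟦ ys ⟧
  f-resp-↭ xs∈E xs↭ys = f-resp-≐ (lookup xs∈E) (∈-resp-↭ xs↭ys , ∈-resp-↭ (↭-sym xs↭ys))

  f-Range-punchIn : ∀ {n} (g : Fin (suc n) → G) t → (∀ u → E (g u)) →
                    f (Range g) ≤ (f (Range (g ∘ punchIn t)) + f ⟦ g t ∷ [] ⟧)
  f-Range-punchIn g t Eg = ≤-trans (monotone (∪-⊆ A'⊆E (⟦x⟧⊆E (Eg t))) (Range-⊆-punchIn g t))
                                   (f-subadditive A'⊆E (⟦x⟧⊆E (Eg t)))
    where
      A'⊆E : Range (g ∘ punchIn t) ⊆ E
      A'⊆E = Range-⊆ {E = E} (λ u → Eg (punchIn t u))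

  ⊆cl-mono : ∀ {X Y Z : Pred G 0ℓ} → Y ⊆ E → X ⊆ E → Z ⊆ Y → X ⊆cl Z → X ⊆cl Y
  ⊆cl-mono {X} {Y} {Z} Y⊆E X⊆E Z⊆Y X⊆clZ = +-cancelʳ-≤ (f Z) (begin
    f (Y ∪ X) + f Z                        ≤⟨ +-mono-≤ (monotone (∪-⊆ Y⊆E Z∪X⊆E) Y∪X⊆)
                                                       (monotone (Y⊆E ∘ proj₁) Z⊆Y∩Z∪X) ⟩
    f (Y ∪ (Z ∪ X)) + f (Y ∩ (Z ∪ X))      ≤⟨ submodular Y⊆E Z∪X⊆E ⟩
    f Y + f (Z ∪ X)                        ≤⟨ +-monoʳ-≤ (f Y) X⊆clZ ⟩
    f Y + f Z                              ∎)
    where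
      open ≤-Reasoning
      Z∪X⊆E : Z ∪ X ⊆ E
      Z∪X⊆E = ∪-⊆ (Y⊆E ∘ Z⊆Y) X⊆E
      Y∪X⊆ : Y ∪ X ⊆ Y ∪ (Z ∪ X)
      Y∪X⊆ = [ inj₁ , inj₂ ∘ inj₂ ]′
      Z⊆Y∩Z∪X : Z ⊆ Y ∩ (Z ∪ X)
      Z⊆Y∩Z∪X z = Z⊆Y z , inj₁ z

  Range-⊆cl : ∀ {n} {Y : Pred G 0ℓ} {g : Fin n → G} → Y ⊆ E → (∀ t → E (g t)) →
              (∀ t → ⟦ g t ∷ [] ⟧ ⊆cl Y) → Range g ⊆cl Y
  Range-⊆cl {zero} Y⊆E Eg gt⊆clY = monotone Y⊆E [ id , (λ { (() , _) }) ]′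
  Range-⊆cl {suc n} {Y} {g} Y⊆E Eg gt⊆clY = begin
    f (Y ∪ Range g)                        ≤⟨ monotone (∪-⊆ Y∪A'⊆E g₀⊆E) Y∪A⊆ ⟩
    f ((Y ∪ Range (g ∘ suc)) ∪ ⟦ g zero ∷ [] ⟧)
                                           ≤⟨ ⊆cl-mono Y∪A'⊆E g₀⊆E inj₁ (gt⊆clY zero) ⟩
    f (Y ∪ Range (g ∘ suc))                ≤⟨ Range-⊆cl Y⊆E (λ t → Eg (suc t)) (gt⊆clY ∘ suc) ⟩
    f Y                                    ∎
    where
      open ≤-Reasoning
      Y∪A'⊆E : Y ∪ Range (g ∘ suc) ⊆ E
      Y∪A'⊆E = ∪-⊆ Y⊆E (Range-⊆ {E = E} (λ t → Eg (suc t)))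
      g₀⊆E : ⟦ g zero ∷ [] ⟧ ⊆ E
      g₀⊆E = ⟦x⟧⊆E (Eg zero)
      Y∪A⊆ : Y ∪ Range g ⊆ (Y ∪ Range (g ∘ suc)) ∪ ⟦ g zero ∷ [] ⟧
      Y∪A⊆ = [ inj₁ ∘ inj₁ , [ inj₁ ∘ inj₂ , inj₂ ]′ ∘ Range-⊆-punchIn g zero ]′

Joins : {n r : ℕ} → (Fin n → Fin r) → (Fin n → Fin r) → Fin n → Fin r → Fin r → Set
Joins i j t x y = (i t ≡ x × j t ≡ y) ⊎ (i t ≡ y × j t ≡ x)

Loopless : {n r : ℕ} → (Fin n → Fin r) → (Fin n → Fin r) → Set
Loopless i j = ∀ t → i t ≢ j t

Simple : {n r : ℕ} → (Fin n → Fin r) → (Fin n → Fin r) → Set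
Simple i j = ∀ t u → t ≢ u → ¬ Joins i j t (i u) (j u)

record LeafEdge {n r : ℕ} (i j : Fin n → Fin r) : Set where
  field
    edge     : Fin n
    leaf     : Fin r
    other    : Fin r
    joins    : Joins i j edge leaf other
    isolated : ∀ u → u ≢ edge → i u ≢ leaf × j u ≢ leaf

module JoinsProperties {n r : ℕ} (i j : Fin n → Fin r) where

  Joins-sym : ∀ {t x y} → Joins i j t x y → Joins i j t y x
  Joins-sym = [ inj₂ , inj₁ ]′

  Joins-other : ∀ {t x} → i t ≡ x ⊎ j t ≡ x → ∃ λ y → Joins i j t x y
  Joins-other {t} (inj₁ it≡x) = j t , inj₁ (it≡x , refl)
  Joins-other {t} (inj₂ jt≡x) = i t , inj₂ (refl , jt≡x)

  Joins-≢ : ∀ {t x y} → i t ≢ j t → Joins i j t x y → x ≢ y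
  Joins-≢ it≢jt (inj₁ (refl , refl)) = it≢jt
  Joins-≢ it≢jt (inj₂ (refl , refl)) = ≢-sym it≢jt

  Joins-same-ends : ∀ {t u x y} → Joins i j t x y → Joins i j u x y → Joins i j u (i t) (j t)
  Joins-same-ends (inj₁ (refl , refl)) ju = ju
  Joins-same-ends (inj₂ (refl , refl)) ju = Joins-sym ju

  module _ {m : ℕ} (h : Fin m → Fin n) where

    Simple-∘ : Injective _≡_ _≡_ h → Simple i j → Simple (i ∘ h) (j ∘ h)
    Simple-∘ h-inj simple t u t≢u = simple (h t) (h u) (t≢u ∘ h-inj)

    HasCycle-∘ : HasCycle (i ∘ h) (j ∘ h) → HasCycle i j
    HasCycle-∘ (k , v , v-inj , adjacent , closing) =
      k , v , v-inj , lift ∘ adjacent , lift closing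
      where
        lift : ∀ {x y} → Adj (i ∘ h) (j ∘ h) x y → Adj i j x y
        lift (t , jt) = h t , jt

-- Longest-path argument: a path that cannot be extended at its start ends in a
-- leaf, and in an acyclic simple graph it can be extended at most r times.
module Forest {n r : ℕ} {i j : Fin n → Fin r}
  (loopless : Loopless i j) (simple : Simple i j) (acyclic : ¬ HasCycle i j) where
  open JoinsProperties i j

  no-loop : ∀ {u x} → ¬ Joins i j u x x
  no-loop {u} ju = Joins-≢ (loopless u) ju refl

  no-parallel : ∀ {u t x y} → u ≢ t → Joins i j u x y → ¬ Joins i j t x y
  no-parallel {u} {t} u≢t ju jt = simple u t u≢t (Joins-same-ends jt ju)

  -- Only vertex 0, …, vertex (m − 1) lie on the path.
  record Path (m : ℕ) : Set where
    field
      vertex      : ℕ → Fin r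
      injective   : ∀ {a c} → a ℕ.< m → c ℕ.< m → vertex a ≡ vertex c → a ≡ c
      adjacent    : ∀ {l} → suc l ℕ.< m → Adj i j (vertex l) (vertex (suc l))
      first       : Fin n
      first-joins : Joins i j first (vertex 0) (vertex 1)

  edge-path : Fin n → Path 2
  edge-path t = record
    { vertex      = vertex
    ; injective   = injective
    ; adjacent    = λ { {zero} _ → t , inj₁ (refl , refl) ; {suc _} (s≤s (s≤s ())) }
    ; first       = t
    ; first-joins = inj₁ (refl , refl)
    }
    where
      vertex : ℕ → Fin r
      vertex zero    = i t
      vertex (suc _) = j t
      injective : ∀ {a c} → a ℕ.< 2 → c ℕ.< 2 → vertex a ≡ vertex c → a ≡ c
      injective {zero}        {zero}        _ _ _     = refl
      injective {zero}        {suc zero}    _ _ it≡jt = ⊥-elim (loopless t it≡jt)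
      injective {suc zero}    {zero}        _ _ jt≡it = ⊥-elim (loopless t (sym jt≡it))
      injective {suc zero}    {suc zero}    _ _ _     = refl
      injective {suc (suc _)} (s≤s (s≤s ()))
      injective {_}           {suc (suc _)} _ (s≤s (s≤s ()))

  Path-m≤r : ∀ {m} → Path m → m ℕ.≤ r
  Path-m≤r p = ℕ.≮⇒≥ λ r<m →
    let a , c , a<c , same = Fin.pigeonhole r<m (Path.vertex p ∘ toℕ)
    in  ℕ.<-irrefl (Path.injective p (Fin.toℕ<n a) (Fin.toℕ<n c) same) a<c

  module _ {m : ℕ} (p : Path m) where
    open Path p

    closes-cycle : ∀ {u w k} → u ≢ first → Joins i j u (vertex 0) w →
                   k ℕ.< m → vertex k ≡ w → ⊥
    closes-cycle {k = zero}        _   ju _   refl = no-loop ju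
    closes-cycle {k = suc zero}    u≢f ju _   refl = no-parallel u≢f ju first-joins
    closes-cycle {u} {k = suc (suc k)} _ ju k<m refl = acyclic (k , vertex ∘ toℕ , v-inj , v-adj , v-closing)
      where
        in-path : ∀ (x : Fin (suc (suc (suc k)))) → toℕ x ℕ.< m
        in-path x = ℕ.<-≤-trans (Fin.toℕ<n x) k<m
        v-inj : Injective _≡_ _≡_ (vertex ∘ toℕ)
        v-inj {x} {y} same = Fin.toℕ-injective (injective (in-path x) (in-path y) same)
        v-adj : ∀ l → Adj i j (vertex (toℕ (inject₁ l))) (vertex (toℕ (suc l)))
        v-adj l rewrite Fin.toℕ-inject₁ l = adjacent (in-path (suc l))
        v-closing : Adj i j (vertex (toℕ (Fin.fromℕ (suc (suc k))))) (vertex 0)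
        v-closing rewrite Fin.toℕ-fromℕ (suc (suc k)) = u , Joins-sym ju

    prepend : ∀ {u w} → Joins i j u (vertex 0) w → (∀ {k} → k ℕ.< m → vertex k ≢ w) → Path (suc m)
    prepend {u} {w} ju off-path = record
      { vertex      = vertex′
      ; injective   = injective′
      ; adjacent    = adjacent′
      ; first       = u
      ; first-joins = Joins-sym ju
      }
      where
        vertex′ : ℕ → Fin r
        vertex′ zero    = w
        vertex′ (suc a) = vertex a
        injective′ : ∀ {a c} → a ℕ.< suc m → c ℕ.< suc m → vertex′ a ≡ vertex′ c → a ≡ c
        injective′ {zero}  {zero}  _   _   _    = refl
        injective′ {zero}  {suc c} _   c<m same = ⊥-elim (off-path (s<s⁻¹ c<m) (sym same))
        injective′ {suc a} {zero}  a<m _   same = ⊥-elim (off-path (s<s⁻¹ a<m) same)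
        injective′ {suc a} {suc c} a<m c<m same = cong suc (injective (s<s⁻¹ a<m) (s<s⁻¹ c<m) same)
        adjacent′ : ∀ {l} → suc l ℕ.< suc m → Adj i j (vertex′ l) (vertex′ (suc l))
        adjacent′ {zero}  _  = u , Joins-sym ju
        adjacent′ {suc l} sl<m = adjacent (s<s⁻¹ sl<m)

    another-edge-at-start? : Dec (∃ λ u → u ≢ first × (i u ≡ vertex 0 ⊎ j u ≡ vertex 0))
    another-edge-at-start? =
      Fin.any? λ u → ¬? (u Fin.≟ first) ×-dec (i u Fin.≟ vertex 0 ⊎-dec j u Fin.≟ vertex 0)

    extend : LeafEdge i j ⊎ Path (suc m)
    extend with another-edge-at-start?
    ... | no isolated = inj₁ record
      { edge     = first
      ; leaf     = vertex 0
      ; other    = vertex 1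
      ; joins    = first-joins
      ; isolated = λ u u≢f → (λ iu≡ → isolated (u , u≢f , inj₁ iu≡))
                           , (λ ju≡ → isolated (u , u≢f , inj₂ ju≡))
      }
    ... | yes (u , u≢f , meets) with Joins-other meets
    ...   | w , ju with ℕ.anyUpTo? (λ k → vertex k Fin.≟ w) m
    ...     | yes (k , k<m , on-path) = ⊥-elim (closes-cycle u≢f ju k<m on-path)
    ...     | no off-path = inj₂ (prepend ju (λ k<m on-path → off-path (_ , k<m , on-path)))

  grow : ∀ k {m} → r ℕ.< k ℕ.+ m → Path m → LeafEdge i j
  grow zero    r<m p = ⊥-elim (ℕ.<⇒≱ r<m (Path-m≤r p))
  grow (suc k) {m} r<k+m p with extend p
  ... | inj₁ leaf = leaf
  ... | inj₂ p′   = grow k (subst (r ℕ.<_) (sym (ℕ.+-suc k m)) r<k+m) p′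

  leaf-edge : Fin n → LeafEdge i j
  leaf-edge t = grow r (ℕ.m<m+n r (s≤s ℕ.z≤n)) (edge-path t)

sub-flip : ∀ {r} {S : Set} (inv : S → S) → (∀ σ → inv (inv σ) ≡ σ) →
           (x y : Fin r) (σ : S) → x ≢ y → sub inv y x (inv σ) ≡ sub inv x y σ
sub-flip inv invol x y σ x≢y with Fin.<-cmp x y | Fin.<-cmp y x
... | tri< x<y _ _ | tri< y<x _ _ = ⊥-elim (Fin.<-asym x<y y<x)
... | tri< _ _ _   | tri≈ _ y≡x _ = ⊥-elim (x≢y (sym y≡x))
... | tri< x<y _ _ | tri> _ _ x<y′ = cong₂ (el x y) (Fin.<-irrelevant x<y′ x<y) (invol σ)
... | tri≈ _ x≡y _ | _            = ⊥-elim (x≢y x≡y)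
... | tri> _ _ y<x | tri< y<x′ _ _ = cong (λ y<x″ → el y x y<x″ (inv σ)) (Fin.<-irrelevant y<x′ y<x)
... | tri> _ _ _   | tri≈ _ y≡x _ = ⊥-elim (x≢y (sym y≡x))
... | tri> _ _ y<x | tri> _ _ x<y = ⊥-elim (Fin.<-asym y<x x<y)

x≢y⇒x∈∁⁅y⁆ : ∀ {r} {x y : Fin r} → x ≢ y → x ∈ ∁ ⁅ y ⁆
x≢y⇒x∈∁⁅y⁆ x≢y = x∉p⇒x∈∁p (x≢y⇒x∉⁅y⁆ x≢y)

∣⊤∣≡suc∣∁⁅x⁆∣ : ∀ {r} (x : Fin r) → ∣ ⊤ {r} ∣ ≡ suc ∣ ∁ ⁅ x ⁆ ∣
∣⊤∣≡suc∣∁⁅x⁆∣ {suc r} x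
  rewrite ∣⊤∣≡n (suc r) | ∣∁p∣≡n∸∣p∣ ⁅ x ⁆ | ∣⁅x⁆∣≡1 x = refl

module IncoherentPDGProperties (R : RealField) (r : ℕ) (S : Set) (inv : S → S) (e : S)
  (E : Pred (Ground r S) 0ℓ) (f : Pred (Ground r S) 0ℓ → RealField.Carrier R)
  (pdg : IncoherentPDG R r S inv e E f) where
  open RealField R
    using (_≈_; _≤_; _+_; 0#; 1#; fromℕ'; +-comm; +-cong; +-congˡ; +-congʳ; +-identityʳ; +-commutativeSemigroup)
  open import Algebra.Properties.CommutativeSemigroup +-commutativeSemigroup using (xy∙z≈xz∙y)
  open OrderedFieldProperties R
  open IncoherentPDG pdg
  open IsPolymatroid polymatroid
  open PolymatroidProperties R polymatroid

  b[_] : Subset r → Pred (Ground r S) 0ℓ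
  b[ Q ] g = ∃ λ x → g ≡ b x × x ∈ Q

  b[]⊆E : ∀ {Q} → b[ Q ] ⊆ E
  b[]⊆E (x , refl , _) = B⊆E x

  ⟦b⟧⊆E : ∀ {x} → ⟦ b x ∷ [] ⟧ ⊆ E
  ⟦b⟧⊆E {x} = ⟦x⟧⊆E (B⊆E x)

  elems : ∀ {n} → (Fin n → S) → (Fin n → Fin r) → (Fin n → Fin r) → Fin n → Ground r S
  elems s i j t = sub inv (i t) (j t) (s t)

  line-through : ∀ {x y v w : Fin r} σ → x ≢ y → (x ≡ v × y ≡ w) ⊎ (x ≡ w × y ≡ v) →
                 ∃ λ σ′ → sub inv w v σ′ ≡ sub inv x y σ
  line-through σ x≢y (inj₁ (refl , refl)) = inv σ , sub-flip inv inv-invol _ _ σ x≢y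
  line-through σ x≢y (inj₂ (refl , refl)) = σ , refl

  f-b : ∀ x → f ⟦ b x ∷ [] ⟧ ≈ 1#
  f-b x = begin
    f ⟦ b x ∷ [] ⟧      ≈⟨ f-resp-≐ ⟦b⟧⊆E (⊆b[⁅x⁆] , b[⁅x⁆]⊆) ⟩
    f b[ ⁅ x ⁆ ]         ≈⟨ indepB ⁅ x ⁆ ⟩
    fromℕ' ∣ ⁅ x ⁆ ∣     ≡⟨ cong fromℕ' (∣⁅x⁆∣≡1 x) ⟩
    1# + 0#              ≈⟨ +-identityʳ 1# ⟩
    1#                   ∎
    where
      open ≈-Reasoning
      ⊆b[⁅x⁆] : ⟦ b x ∷ [] ⟧ ⊆ b[ ⁅ x ⁆ ]
      ⊆b[⁅x⁆] (here refl) = x , refl , x∈⁅x⁆ x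
      b[⁅x⁆]⊆ : b[ ⁅ x ⁆ ] ⊆ ⟦ b x ∷ [] ⟧
      b[⁅x⁆]⊆ (y , refl , y∈⁅x⁆) = here (cong b (x∈⁅y⁆⇒x≡y x y∈⁅x⁆))

  f-bb≤2 : ∀ x y → f ⟦ b x ∷ b y ∷ [] ⟧ ≤ (1# + 1#)
  f-bb≤2 x y = begin
    f ⟦ b x ∷ b y ∷ [] ⟧                 ≈⟨ f-++ (b x ∷ []) _ (B⊆E x ∷ B⊆E y ∷ []) ⟩
    f (⟦ b x ∷ [] ⟧ ∪ ⟦ b y ∷ [] ⟧)      ≤⟨ f-subadditive ⟦b⟧⊆E ⟦b⟧⊆E ⟩
    f ⟦ b x ∷ [] ⟧ + f ⟦ b y ∷ [] ⟧      ≈⟨ +-cong (f-b x) (f-b y) ⟩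
    1# + 1#                              ∎
    where open ≤-Reasoning

  module _ {x y : Fin r} {σ : S} (x≢y : x ≢ y) (Ea : E (sub inv x y σ)) where

    line⊆cl : ⟦ sub inv x y σ ∷ [] ⟧ ⊆cl ⟦ b x ∷ b y ∷ [] ⟧
    line⊆cl = ≤-reflexive (begin
      f (⟦ b x ∷ b y ∷ [] ⟧ ∪ ⟦ sub inv x y σ ∷ [] ⟧)  ≈⟨ f-++ (b x ∷ b y ∷ []) _ (B⊆E x ∷ B⊆E y ∷ Ea ∷ []) ⟨
      f ⟦ b x ∷ b y ∷ sub inv x y σ ∷ [] ⟧             ≈⟨ inCl x y σ x≢y Ea ⟩
      f ⟦ b x ∷ b y ∷ [] ⟧                             ∎)
      where open ≈-Reasoning

    b⊆cl : ⟦ b y ∷ [] ⟧ ⊆cl ⟦ b x ∷ sub inv x y σ ∷ [] ⟧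
    b⊆cl = begin
      f (⟦ b x ∷ sub inv x y σ ∷ [] ⟧ ∪ ⟦ b y ∷ [] ⟧)  ≈⟨ f-++ (b x ∷ sub inv x y σ ∷ []) _ xay∈E ⟨
      f ⟦ b x ∷ sub inv x y σ ∷ b y ∷ [] ⟧             ≈⟨ f-resp-↭ xay∈E xay↭xya ⟩
      f ⟦ b x ∷ b y ∷ sub inv x y σ ∷ [] ⟧             ≈⟨ inCl x y σ x≢y Ea ⟩
      f ⟦ b x ∷ b y ∷ [] ⟧                             ≤⟨ f-bb≤2 x y ⟩
      1# + 1#                                          ≈⟨ rankbi x y σ x≢y Ea ⟨
      f ⟦ b x ∷ sub inv x y σ ∷ [] ⟧                   ∎
      where
        open ≤-Reasoning
        xay↭xya : b x ∷ sub inv x y σ ∷ b y ∷ [] ↭ b x ∷ b y ∷ sub inv x y σ ∷ []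
        xay↭xya = prep (b x) (swap (sub inv x y σ) (b y) refl)
        xay∈E : All E (b x ∷ sub inv x y σ ∷ b y ∷ [])
        xay∈E = B⊆E x ∷ Ea ∷ B⊆E y ∷ []

  Range-⊆cl-b : ∀ {n} {Q : Subset r} (s : Fin n → S) (i j : Fin n → Fin r) →
                Loopless i j → (∀ t → E (elems s i j t)) → (∀ t → i t ∈ Q × j t ∈ Q) →
                Range (elems s i j) ⊆cl b[ Q ]
  Range-⊆cl-b s i j loopless Eelems in-Q = Range-⊆cl b[]⊆E Eelems λ t →
    ⊆cl-mono b[]⊆E (⟦x⟧⊆E (Eelems t)) (bb⊆b[Q] t) (line⊆cl (loopless t) (Eelems t))
    where
      bb⊆b[Q] : ∀ t → ⟦ b (i t) ∷ b (j t) ∷ [] ⟧ ⊆ b[ _ ]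
      bb⊆b[Q] t (here refl)         = i t , refl , proj₁ (in-Q t)
      bb⊆b[Q] t (there (here refl)) = j t , refl , proj₂ (in-Q t)

  rank-add-line : ∀ {A A' v w σ} → A ⊆ E → A' ⊆ A → w ≢ v → A (sub inv w v σ) →
                  A' ⊆cl b[ ∁ ⁅ v ⁆ ] → (1# + f A') ≤ f A
  rank-add-line {A} {A'} {v} {w} {σ} A⊆E A'⊆A w≢v a∈A A'⊆cl = +-cancelʳ-≤ N (begin
    1# + f A' + N                           ≈⟨ xy∙z≈xz∙y 1# (f A') N ⟩
    fromℕ' (suc ∣ Q ∣) + f A'                ≡⟨ cong (λ k → fromℕ' k + f A') (∣⊤∣≡suc∣∁⁅x⁆∣ v) ⟨
    fromℕ' ∣ ⊤ {r} ∣ + f A'                  ≈⟨ +-congʳ (indepB ⊤) ⟨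
    f b[ ⊤ ] + f A'                         ≤⟨ +-mono-≤ fB≤fA∪X∪bv fA'≤fA∩X ⟩
    f ((A ∪ X) ∪ ⟦ b v ∷ [] ⟧) + f (A ∩ X)  ≤⟨ +-monoˡ-≤ _ bv∈cl ⟩
    f (A ∪ X) + f (A ∩ X)                   ≤⟨ submodular A⊆E X⊆E ⟩
    f A + f X                               ≤⟨ +-monoʳ-≤ (f A) fX≤N ⟩
    f A + N                                 ∎)
    where
      open ≤-Reasoning
      Q = ∁ ⁅ v ⁆
      N = fromℕ' ∣ Q ∣
      X = b[ Q ] ∪ A'
      X⊆E : X ⊆ E
      X⊆E = ∪-⊆ b[]⊆E (A⊆E ∘ A'⊆A)
      A∪X⊆E : A ∪ X ⊆ E
      A∪X⊆E = ∪-⊆ A⊆E X⊆E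
      fX≤N : f X ≤ N
      fX≤N = ≤-trans A'⊆cl (≤-reflexive (indepB Q))
      Z⊆A∪X : ⟦ b w ∷ sub inv w v σ ∷ [] ⟧ ⊆ A ∪ X
      Z⊆A∪X (here refl)         = inj₂ (inj₁ (w , refl , x≢y⇒x∈∁⁅y⁆ w≢v))
      Z⊆A∪X (there (here refl)) = inj₁ a∈A
      bv∈cl : ⟦ b v ∷ [] ⟧ ⊆cl (A ∪ X)
      bv∈cl = ⊆cl-mono A∪X⊆E ⟦b⟧⊆E Z⊆A∪X (b⊆cl w≢v (A⊆E a∈A))
      b[⊤]⊆ : b[ ⊤ ] ⊆ (A ∪ X) ∪ ⟦ b v ∷ [] ⟧
      b[⊤]⊆ (x , refl , _) with x Fin.≟ v
      ... | yes refl = inj₂ (here refl)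
      ... | no x≢v   = inj₁ (inj₂ (inj₁ (x , refl , x≢y⇒x∈∁⁅y⁆ x≢v)))
      fB≤fA∪X∪bv : f b[ ⊤ ] ≤ f ((A ∪ X) ∪ ⟦ b v ∷ [] ⟧)
      fB≤fA∪X∪bv = monotone (∪-⊆ A∪X⊆E ⟦b⟧⊆E) b[⊤]⊆
      fA'≤fA∩X : f A' ≤ f (A ∩ X)
      fA'≤fA∩X = monotone (A⊆E ∘ proj₁) (λ a∈A' → A'⊆A a∈A' , inj₂ a∈A')

  rank-remove-leaf : ∀ {n} (s : Fin (suc n) → S) (i j : Fin (suc n) → Fin r) →
                     Loopless i j → (∀ t → E (elems s i j t)) → (ℓ : LeafEdge i j) →
                     f (Range (elems s i j)) ≈ 1# + f (Range (elems s i j ∘ punchIn (LeafEdge.edge ℓ)))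
  rank-remove-leaf s i j loopless Eelems ℓ = antisym upper lower
    where
      open LeafEdge ℓ renaming (edge to t; leaf to v; other to w)
      A' = Range (elems s i j ∘ punchIn t)
      upper : f (Range (elems s i j)) ≤ (1# + f A')
      upper = begin
        f (Range (elems s i j))                 ≤⟨ f-Range-punchIn (elems s i j) t Eelems ⟩
        f A' + f ⟦ elems s i j t ∷ [] ⟧         ≈⟨ +-congˡ (rank1 (i t) (j t) (s t) (loopless t) (Eelems t)) ⟩
        f A' + 1#                               ≈⟨ +-comm (f A') 1# ⟩
        1# + f A'                               ∎
        where open ≤-Reasoning
      a-on-line : ∃ λ σ → sub inv w v σ ≡ elems s i j t
      a-on-line = line-through (s t) (loopless t) joins
      avoids-v : ∀ u → i (punchIn t u) ∈ ∁ ⁅ v ⁆ × j (punchIn t u) ∈ ∁ ⁅ v ⁆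
      avoids-v u with isolated (punchIn t u) (Fin.punchInᵢ≢i t u)
      ... | iu≢v , ju≢v = x≢y⇒x∈∁⁅y⁆ iu≢v , x≢y⇒x∈∁⁅y⁆ ju≢v
      lower : (1# + f A') ≤ f (Range (elems s i j))
      lower = rank-add-line (Range-⊆ Eelems) (Range-∘-⊆ (punchIn t))
                (≢-sym (JoinsProperties.Joins-≢ i j (loopless t) joins))
                (t , proj₂ a-on-line)
                (Range-⊆cl-b (s ∘ punchIn t) (i ∘ punchIn t) (j ∘ punchIn t)
                  (loopless ∘ punchIn t) (λ u → Eelems (punchIn t u)) avoids-v)

  rank-forest : ∀ n (s : Fin n → S) (i j : Fin n → Fin r) → Loopless i j → Simple i j →
                (∀ t → E (elems s i j t)) → ¬ HasCycle i j → f (Range (elems s i j)) ≈ fromℕ' n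
  rank-forest zero s i j _ _ _ _ = f-Range-Fin0 (elems s i j)
  rank-forest (suc n) s i j loopless simple Eelems acyclic = begin
    f (Range (elems s i j))                  ≈⟨ rank-remove-leaf s i j loopless Eelems ℓ ⟩
    1# + f (Range (elems s i j ∘ punchIn t)) ≈⟨ +-congˡ (rank-forest n (s ∘ punchIn t) (i ∘ punchIn t) (j ∘ punchIn t)
                                                   (loopless ∘ punchIn t) simple′ (λ u → Eelems (punchIn t u)) acyclic′) ⟩
    1# + fromℕ' n                            ∎
    where
      open ≈-Reasoning
      open JoinsProperties i j using (Simple-∘; HasCycle-∘)
      ℓ = Forest.leaf-edge loopless simple acyclic zero
      t = LeafEdge.edge ℓ
      simple′ : Simple (i ∘ punchIn t) (j ∘ punchIn t)
      simple′ = Simple-∘ (punchIn t) (Fin.punchIn-injective t _ _) simple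
      acyclic′ : ¬ HasCycle (i ∘ punchIn t) (j ∘ punchIn t)
      acyclic′ = acyclic ∘ HasCycle-∘ (punchIn t)

lemma4p5 : (R : RealField) (r : ℕ) (S : Set) (inv : S → S) (e : S)
    (E : Pred (Ground r S) 0ℓ) (f : Pred (Ground r S) 0ℓ → RealField.Carrier R) →
    PossiblyIncoherentPDG R r S inv e E f →
    (n : ℕ) (s : Fin n → S) (i j : Fin n → Fin r) →
    (∀ t → i t ≢ j t) →
    (∀ t u → t ≢ u → ¬ ((i t ≡ i u × j t ≡ j u) ⊎ (i t ≡ j u × j t ≡ i u))) →
    (∀ t → E (sub inv (i t) (j t) (s t))) →
    ¬ HasCycle i j →
    RealField._≈_ R (f (λ g → ∃ λ t → g ≡ sub inv (i t) (j t) (s t))) (RealField.fromℕ' R n)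
lemma4p5 R r S inv e E f pdg =
  IncoherentPDGProperties.rank-forest R r S inv e E f ([ PDG.base , id ]′ pdg)
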